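{- For any integer $n\geq 2$, \[ B_n^+(t)=D_n^+(t)+nB_{n-1}^-(t),\qquad B_n^-(t)=D_n^-(t)+ntB_{n-1}^+(t). \]
   Context: $\mathfrak{B}_n$ is the set of signed permutations $\pi=\pi_1\cdots\pi_n$ of $[n]$ (each of $1,\dots,n$ appears exactly once, with a sign). With $\pi_0=0$, $\mathrm{des}_B(\pi)=|\{k\in\{0,\dots,n-1\}:\pi_k>\pi_{k+1}\}|$. $\mathfrak{D}_n\subset\mathfrak{B}_n$ is the set of signed permutations with an even number of negative entries; for $\pi\in\mathfrak{D}_n$, $\mathrm{Des}_D(\pi)=\{0 : \pi_1+\pi_2<0\}\cup\{k\in\{1,\dots,n-1\}:\pi_k>\pi_{k+1}\}$ and $\mathrm{des}_D(\pi)=|\mathrm{Des}_D(\pi)|$. Let $\mathfrak{B}_n^{+}=\{\pi\in\mathfrak{B}_n:\pi_n>0\}$, $\mathfrak{B}_n^{ - }=\{\pi\in\mathfrak{B}_n:\pi_n<0\}$, $\mathfrak{D}_n^{\pm}=\mathfrak{D}_n\cap\mathfrak{B}_n^{\pm}$, and define the half Eulerian polynomials $B_n^{\pm}(t)=\sum_{\pi\in\mathfrak{B}_n^{\pm}}t^{\mathrm{des}_B(\pi)}$ and $D_n^{\pm}(t)=\sum_{\pi\in\mathfrak{D}_n^{\pm}}t^{\mathrm{des}_D(\pi)}$. -}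

module Defs where

open import Data.Nat as ℕ using (ℕ; zero; suc)
open import Data.Integer as ℤ using (ℤ; +_; -_; ∣_∣; 0ℤ)
open import Data.Integer.Properties using ()
open import Data.Bool using (Bool; true; false; _∧_; not; if_then_else_)
open import Data.List using (List; []; _∷_; map; _++_; concatMap; filter; length; upTo)
open import Data.Bool.ListAction using (all; any)
open import Relation.Binary.PropositionalEquality using (_≡_)
open import Relation.Nullary.Decidable using (⌊_⌋)

-- A (candidate) signed permutation of [n] is a one-line word π₁⋯πₙ of integers.
Word : Set
Word = List ℤ

letters : ℕ → List ℤ
letters n = map (λ i → + suc i) (upTo n) ++ map (λ i → - (+ suc i)) (upTo n)

words : List ℤ → ℕ → List Word
words A zero = [] ∷ []
words A (suc m) = concatMap (λ a → map (a ∷_) (words A m)) A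

_==ℕ_ : ℕ → ℕ → Bool
m ==ℕ k = ⌊ m ℕ.≟ k ⌋

-- every i ∈ {1,…,n} occurs (with some sign) in w; for a word of length n
-- over ±[n] this says exactly that w is a signed permutation
coversAll : ℕ → Word → Bool
coversAll n w = all (λ i → any (λ x → ∣ x ∣ ==ℕ suc i) w) (upTo n)

signedPerms : ℕ → List Word
signedPerms n = filter (λ w → Data.Bool._≟_ (coversAll n w) true) (words (letters n) n)

_<ℤ_ : ℤ → ℤ → Bool
a <ℤ b = ⌊ a ℤ.<? b ⌋

descents : Word → ℕ
descents (a ∷ b ∷ w) = (if b <ℤ a then 1 else 0) ℕ.+ descents (b ∷ w)
descents _ = 0

desB : Word → ℕ
desB w = descents (0ℤ ∷ w)

desD : Word → ℕ
desD (a ∷ b ∷ w) = (if (a ℤ.+ b) <ℤ 0ℤ then 1 else 0) ℕ.+ descents (a ∷ b ∷ w)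
desD w = descents w

negs : Word → ℕ
negs [] = 0
negs (a ∷ w) = (if a <ℤ 0ℤ then 1 else 0) ℕ.+ negs w

inD : Word → Bool
inD w = (negs w ℕ.% 2) ==ℕ 0

lastPos : Word → Bool
lastPos [] = false
lastPos (a ∷ []) = 0ℤ <ℤ a
lastPos (a ∷ b ∷ w) = lastPos (b ∷ w)

lastNeg : Word → Bool
lastNeg [] = false
lastNeg (a ∷ []) = a <ℤ 0ℤ
lastNeg (a ∷ b ∷ w) = lastNeg (b ∷ w)

-- A polynomial in t with natural coefficients, given by its coefficient function
Poly : Set
Poly = ℕ → ℕ

-- Σ_{π ∈ S} t^{stat π}, where S = {π ∈ ws : P π}
genPoly : List Word → (Word → Bool) → (Word → ℕ) → Poly
genPoly ws P stat k = length (filter (λ w → Data.Bool._≟_ (P w ∧ (stat w ==ℕ k)) true) ws)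

Bplus Bminus Dplus Dminus : ℕ → Poly
Bplus  n = genPoly (signedPerms n) lastPos desB
Bminus n = genPoly (signedPerms n) lastNeg desB
Dplus  n = genPoly (signedPerms n) (λ w → inD w ∧ lastPos w) desD
Dminus n = genPoly (signedPerms n) (λ w → inD w ∧ lastNeg w) desD

_⊕_ : Poly → Poly → Poly
(p ⊕ q) k = p k ℕ.+ q k

_⊙_ : ℕ → Poly → Poly
(c ⊙ p) k = c ℕ.* p k

t· : Poly → Poly
t· p zero = 0
t· p (suc k) = p k

_≋_ : Poly → Poly → Set
p ≋ q = ∀ k → p k ≡ q k

-- Evaluate every generating polynomial against an arbitrary weight f : ℕ → ℕ of the
-- statistic (the coefficient of t^k is the weight δ _ k).  Group 𝔅ₙ by the first letter ±a,
-- a > 0.  For a fixed tail w the words a w and (−a) w end in the same letter and have the same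
-- des_D, exactly one of them lies in 𝔇ₙ, and t^des_B(a w) + t^des_B(−a w) = t^des_D(a w) + t^(1 + des w).
-- Hence B±ₙ = D±ₙ + Σₐ Σ_w t^(1 + des w).  The tail w is a signed permutation of [n] ∖ {a};
-- relabelling it by the sign-swapping bijection onto ±[n − 1] that keeps the order of letters of
-- equal sign gives τ ∈ 𝔅ₙ₋₁ with the opposite last sign and 1 + des w = des_B τ + [τ ends positively],
-- so the inner sum is B⁻ₙ₋₁ resp. t B⁺ₙ₋₁, whatever a is.
module Submission where

open import Defs
open import Algebra.Bundles using (Monoid; CommutativeMonoid)
import Algebra.Properties.CommutativeMonoid.Sum as CommutativeMonoidSum
import Algebra.Properties.Monoid.Sum as MonoidSum
import Data.Bool as Bool
open import Data.Bool.Base using (Bool; true; false; T; not; _∧_; _∨_; if_then_else_)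
open import Data.Bool.ListAction using (any)
open import Data.Bool.Properties
  using (T-∨; T-≡; ∧-identityʳ; ∧-zeroʳ; ∧-commutativeMonoid; if-∧; if-eta; if-cong; if-cong-then; if-cong-else)
open import Data.Fin.Base using (Fin; zero; suc; toℕ; punchIn; opposite)
import Data.Fin.Permutation as Permutation
open import Data.Fin.Properties using (opposite-prop; punchInᵢ≢i; toℕ-injective; toℕ<n; injective⇒≤)
import Data.Integer.Base as ℤ
open import Data.Integer.Base using (ℤ; +0; +[1+_]; -[1+_]; 0ℤ; ∣_∣)
import Data.Integer.Properties as ℤ
open import Data.List.Base using (List; []; _∷_; map; lookup; _++_; concatMap; filter; length; upTo; applyUpTo; foldr)
open import Data.List.Properties using (map-++; map-cong; map-cong-local; map-∘)
open import Data.List.Relation.Unary.All as All using (All; []; _∷_)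
open import Data.List.Relation.Unary.All.Properties
  using (++⁺; map⁺; concat⁺; applyUpTo⁺₁; applyUpTo⁻; all⁺; all⁻)
open import Data.List.Relation.Unary.Any as Any using (Any)
open import Data.List.Relation.Unary.Any.Properties using (any⁻; lookup-index)
import Data.Nat as ℕ
open import Data.Nat.Base using (ℕ; zero; suc; _+_; _*_; _∸_; _%_; _<_; _≤_; z≤n; s≤s; z<s; s<s; s<s⁻¹)
open import Data.Nat.ListAction using (sum)
open import Data.Nat.ListAction.Properties using (sum-++)
open import Data.Nat.Properties
  using (suc-injective; +-suc; +-identityʳ; +-assoc; +-comm; <-cmp; <⇒≢; <⇒≯; <-irrefl; ∸-monoʳ-<;
         +-0-monoid; +-0-commutativeMonoid; +-commutativeSemigroup)
open import Algebra.Properties.CommutativeSemigroup +-commutativeSemigroup using (interchange; x∙yz≈y∙xz)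
open import Data.Product.Base using (_×_; _,_)
open import Data.Sum.Base using (inj₁; inj₂)
open import Data.Vec.Functional using (removeAt)
open import Function.Base using (_∘_)
open import Function.Bundles using (_⇔_; mk⇔; module Equivalence)
open import Relation.Binary.Definitions using (tri<; tri≈; tri>)
open import Relation.Binary.PropositionalEquality
open import Relation.Nullary.Decidable
  using (Dec; ⌊_⌋; toWitness; fromWitness; isYes≗does; does-⇔; dec-true; dec-false)
open import Relation.Nullary.Negation using (contradiction)

module _ {c ℓ} (M : Monoid c ℓ) where
  open Monoid M using (Carrier; _∙_; ε)
  open MonoidSum M using () renaming (sum to ∑)

  foldr-map-applyUpTo : ∀ (g : ℕ → Carrier) f n →
    foldr _∙_ ε (map g (applyUpTo f n)) ≡ ∑ {n} (λ j → g (f (toℕ j)))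
  foldr-map-applyUpTo g f zero    = refl
  foldr-map-applyUpTo g f (suc n) = cong (g (f 0) ∙_) (foldr-map-applyUpTo g (f ∘ suc) n)

module _ {c ℓ} (M : CommutativeMonoid c ℓ) where
  open CommutativeMonoid M using (Carrier; _≈_; _∙_; ∙-congˡ) renaming (trans to ≈-trans)
  open CommutativeMonoidSum M using (sum-remove; sum-permute) renaming (sum to ∑)

  ∑-punchIn-opposite : ∀ {n} (i : Fin (suc n)) (t : Fin (suc n) → Carrier) →
    ∑ t ≈ t i ∙ ∑ (λ u → t (punchIn i (opposite u)))
  ∑-punchIn-opposite i t = ≈-trans (sum-remove t) (∙-congˡ (sum-permute (removeAt t i) Permutation.reverse))

open CommutativeMonoidSum +-0-commutativeMonoid using (sum-syntax; ∑-distrib-+) renaming (sum-cong-≗ to ∑-cong)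
open CommutativeMonoidSum ∧-commutativeMonoid using () renaming (sum to ⋀; sum-cong-≗ to ⋀-cong)

∑-const : ∀ n x → ∑[ j < n ] x ≡ n * x
∑-const zero    x = refl
∑-const (suc n) x = cong (x +_) (∑-const n x)

𝟙 : Bool → ℕ
𝟙 b = if b then 1 else 0

module _ {A : Set} where

  sum-map-++ : ∀ (g : A → ℕ) xs ys → sum (map g (xs ++ ys)) ≡ sum (map g xs) + sum (map g ys)
  sum-map-++ g xs ys = trans (cong sum (map-++ g xs ys)) (sum-++ (map g xs) (map g ys))

  sum-map-+ : ∀ (g h : A → ℕ) xs → sum (map (λ x → g x + h x) xs) ≡ sum (map g xs) + sum (map h xs)
  sum-map-+ g h []       = refl
  sum-map-+ g h (x ∷ xs) = begin
    (g x + h x) + sum (map (λ x → g x + h x) xs)    ≡⟨ cong ((g x + h x) +_) (sum-map-+ g h xs) ⟩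
    (g x + h x) + (sum (map g xs) + sum (map h xs)) ≡⟨ interchange (g x) (h x) _ _ ⟩
    (g x + sum (map g xs)) + (h x + sum (map h xs)) ∎
    where open ≡-Reasoning

  sum-map-cong : ∀ {g h : A → ℕ} {xs} → All (λ x → g x ≡ h x) xs → sum (map g xs) ≡ sum (map h xs)
  sum-map-cong = cong sum ∘ map-cong-local

  sum-map-filter : ∀ (g : A → ℕ) (p : A → Bool) xs →
    sum (map g (filter (λ x → p x Bool.≟ true) xs)) ≡ sum (map (λ x → if p x then g x else 0) xs)
  sum-map-filter g p []       = refl
  sum-map-filter g p (x ∷ xs) with p x
  ... | true  = cong (g x +_) (sum-map-filter g p xs)
  ... | false = sum-map-filter g p xs

  length-filter : ∀ (p : A → Bool) xs →
    length (filter (λ x → p x Bool.≟ true) xs) ≡ sum (map (λ x → 𝟙 (p x)) xs)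
  length-filter p []       = refl
  length-filter p (x ∷ xs) with p x
  ... | true  = cong suc (length-filter p xs)
  ... | false = length-filter p xs

sum-map-0 : ∀ {A : Set} (xs : List A) → sum (map (λ _ → 0) xs) ≡ 0
sum-map-0 []       = refl
sum-map-0 (_ ∷ xs) = sum-map-0 xs

sum-map-concatMap : ∀ {A B : Set} (g : B → ℕ) (f : A → List B) xs →
  sum (map g (concatMap f xs)) ≡ sum (map (λ x → sum (map g (f x))) xs)
sum-map-concatMap g f []       = refl
sum-map-concatMap g f (x ∷ xs) =
  trans (sum-map-++ g (f x) (concatMap f xs)) (cong (sum (map g (f x)) +_) (sum-map-concatMap g f xs))

isYes-⇔ : ∀ {P Q : Set} → P ⇔ Q → (p? : Dec P) (q? : Dec Q) → ⌊ p? ⌋ ≡ ⌊ q? ⌋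
isYes-⇔ P⇔Q p? q? = trans (isYes≗does p?) (trans (does-⇔ P⇔Q p? q?) (sym (isYes≗does q?)))

==ℕ-refl : ∀ m → (m ==ℕ m) ≡ true
==ℕ-refl m = trans (isYes≗does (m ℕ.≟ m)) (dec-true (m ℕ.≟ m) refl)

==ℕ-≢ : ∀ {m k} → m ≢ k → (m ==ℕ k) ≡ false
==ℕ-≢ {m} {k} m≢k = trans (isYes≗does (m ℕ.≟ k)) (dec-false (m ℕ.≟ k) m≢k)

suc-==ℕ : ∀ m n → (suc m ==ℕ suc n) ≡ (m ==ℕ n)
suc-==ℕ m n = trans (isYes≗does (suc m ℕ.≟ suc n)) (sym (isYes≗does (m ℕ.≟ n)))

δ : ℕ → ℕ → ℕ
δ d k = 𝟙 (d ==ℕ k)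

genPoly-as-sum : ∀ ws P stat k → genPoly ws P stat k ≡ sum (map (λ w → if P w then δ (stat w) k else 0) ws)
genPoly-as-sum ws P stat k = trans (length-filter _ ws) (cong sum (map-cong (λ w → if-∧ (P w)) ws))

t·-genPoly : ∀ ws P stat → t· (genPoly ws P stat) ≋ genPoly ws P (suc ∘ stat)
t·-genPoly ws P stat zero    = sym (begin
  genPoly ws P (suc ∘ stat) 0               ≡⟨ genPoly-as-sum ws P (suc ∘ stat) 0 ⟩
  sum (map (λ w → if P w then 0 else 0) ws) ≡⟨ cong sum (map-cong (λ w → if-eta (P w)) ws) ⟩
  sum (map (λ _ → 0) ws)                    ≡⟨ sum-map-0 ws ⟩
  0                                         ∎)
  where open ≡-Reasoning
t·-genPoly ws P stat (suc k) = begin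
  genPoly ws P stat k                                        ≡⟨ genPoly-as-sum ws P stat k ⟩
  sum (map (λ w → if P w then δ (stat w) k else 0) ws)       ≡⟨ cong sum (map-cong δ-suc ws) ⟨
  sum (map (λ w → if P w then δ (suc (stat w)) (suc k) else 0) ws) ≡⟨ genPoly-as-sum ws P (suc ∘ stat) (suc k) ⟨
  genPoly ws P (suc ∘ stat) (suc k) ∎
  where
  open ≡-Reasoning
  δ-suc : ∀ w → (if P w then δ (suc (stat w)) (suc k) else 0) ≡ (if P w then δ (stat w) k else 0)
  δ-suc w = if-cong-then (P w) (if-cong (suc-==ℕ (stat w) k))

sum-signedPerms : ∀ n (g : Word → ℕ) →
  sum (map g (signedPerms n)) ≡ sum (map (λ w → if coversAll n w then g w else 0) (words (letters n) n))
sum-signedPerms n g = sum-map-filter g (coversAll n) (words (letters n) n)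

words-All : ∀ {P : ℤ → Set} {A} → All P A → ∀ m → All (λ w → length w ≡ m × All P w) (words A m)
words-All PA zero    = (refl , []) ∷ []
words-All PA (suc m) =
  concat⁺ (map⁺ (All.map (λ pa → map⁺ (All.map (λ (len , pw) → cong suc len , pa ∷ pw) (words-All PA m))) PA))

sum-words-suc : ∀ (g : Word → ℕ) A m →
  sum (map g (words A (suc m))) ≡ sum (map (λ a → sum (map (λ w → g (a ∷ w)) (words A m))) A)
sum-words-suc g A m =
  trans (sum-map-concatMap g _ A) (cong sum (map-cong (λ a → cong sum (sym (map-∘ (words A m)))) A))

data Letter (n : ℕ) : ℤ → Set where
  pos : ∀ {u} → u < n → Letter n +[1+ u ]
  neg : ∀ {u} → u < n → Letter n -[1+ u ]

letters-Letter : ∀ n → All (Letter n) (letters n)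
letters-Letter n = ++⁺ (map⁺ (applyUpTo⁺₁ _ n pos)) (map⁺ (applyUpTo⁺₁ _ n neg))

sum-letters : ∀ n (G : ℤ → ℕ) → sum (map G (letters n)) ≡ ∑[ j < n ] (G (+[1+ toℕ j ]) + G -[1+ toℕ j ])
sum-letters n G = begin
  sum (map G (letters n))                                            ≡⟨ sum-map-++ G (map positive (upTo n)) _ ⟩
  sum (map G (map positive (upTo n))) + sum (map G (map negative (upTo n)))
    ≡⟨ cong₂ _+_ (cong sum (map-∘ (upTo n))) (cong sum (map-∘ (upTo n))) ⟨
  sum (map (G ∘ positive) (upTo n)) + sum (map (G ∘ negative) (upTo n))
    ≡⟨ cong₂ _+_ (foldr-map-applyUpTo +-0-monoid _ _ n) (foldr-map-applyUpTo +-0-monoid _ _ n) ⟩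
  ∑[ j < n ] G (+[1+ toℕ j ]) + ∑[ j < n ] G -[1+ toℕ j ]           ≡⟨ ∑-distrib-+ {n} _ _ ⟨
  ∑[ j < n ] (G (+[1+ toℕ j ]) + G -[1+ toℕ j ])                    ∎
  where
  open ≡-Reasoning
  positive negative : ℕ → ℤ
  positive u = +[1+ u ]
  negative u = -[1+ u ]

covers : ℕ → Word → Bool
covers i w = any (λ x → ∣ x ∣ ==ℕ suc i) w

coversAll-as-⋀ : ∀ n w → coversAll n w ≡ ⋀ {n} (λ j → covers (toℕ j) w)
coversAll-as-⋀ n w = foldr-map-applyUpTo (CommutativeMonoid.monoid ∧-commutativeMonoid) (λ j → covers j w) (λ j → j) n

coversAll⇒≤length : ∀ n w → T (coversAll n w) → n ≤ length w
coversAll⇒≤length n w cov = injective⇒≤ position-injective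
  where
  witness : ∀ (j : Fin n) → Any (λ x → T (∣ x ∣ ==ℕ suc (toℕ j))) w
  witness j = any⁻ _ w (applyUpTo⁻ (λ j → j) n (all⁺ _ (upTo n) cov) (toℕ<n j))
  position : Fin n → Fin (length w)
  position j = Any.index (witness j)
  value : ∀ j → ∣ lookup w (position j) ∣ ≡ suc (toℕ j)
  value j = toWitness (lookup-index (witness j))
  position-injective : ∀ {j k} → position j ≡ position k → j ≡ k
  position-injective {j} {k} eq =
    toℕ-injective (suc-injective (trans (sym (value j)) (trans (cong (λ p → ∣ lookup w p ∣) eq) (value k))))

-- a second occurrence of ±(i+1) would leave n letters covering n + 1 values
coversAll-head⇒¬covers : ∀ {n i w} → length w ≡ n → T (coversAll (suc n) (+[1+ i ] ∷ w)) → covers i w ≡ false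
coversAll-head⇒¬covers {n} {i} {w} refl cov with covers i w in eq
... | false = refl
... | true  = contradiction (coversAll⇒≤length (suc n) w coversAll-tail) (<-irrefl refl)
  where
  tail-covers : ∀ j → T (covers j (+[1+ i ] ∷ w)) → T (covers j w)
  tail-covers j c with Equivalence.to (T-∨ {suc i ==ℕ suc j} {covers j w}) c
  ... | inj₁ i≡j = subst (λ k → T (covers k w)) (suc-injective (toWitness i≡j)) (Equivalence.from T-≡ eq)
  ... | inj₂ c′  = c′
  coversAll-tail : T (coversAll (suc n) w)
  coversAll-tail = all⁻ _ (applyUpTo⁺₁ (λ j → j) (suc n)
    (λ {j} j<n → tail-covers j (applyUpTo⁻ (λ j → j) (suc n) (all⁺ _ _ cov) j<n)))

sum-words-relabel : ∀ {A A′ : List ℤ} (q : ℤ → Bool) (h : ℤ → ℤ) →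
  (∀ (G : ℤ → ℕ) → sum (map (λ a → if q a then 0 else G a) A) ≡ sum (map (G ∘ h) A′)) →
  ∀ m (F : Word → ℕ) →
  sum (map (λ w → if any q w then 0 else F w) (words A m)) ≡ sum (map (F ∘ map h) (words A′ m))
sum-words-relabel q h letters-relabel zero    F = refl
sum-words-relabel {A} {A′} q h letters-relabel (suc m) F = begin
  sum (map (λ w → if any q w then 0 else F w) (words A (suc m)))
    ≡⟨ sum-words-suc _ A m ⟩
  sum (map (λ a → sum (map (λ w → if q a ∨ any q w then 0 else F (a ∷ w)) (words A m))) A)
    ≡⟨ cong sum (map-cong split A) ⟩
  sum (map (λ a → if q a then 0 else sum (map (λ w → if any q w then 0 else F (a ∷ w)) (words A m))) A)
    ≡⟨ cong sum (map-cong (λ a → if-cong-else (q a) (sum-words-relabel q h letters-relabel m (F ∘ (a ∷_)))) A) ⟩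
  sum (map (λ a → if q a then 0 else sum (map (λ τ → F (a ∷ map h τ)) (words A′ m))) A)
    ≡⟨ letters-relabel (λ a → sum (map (λ τ → F (a ∷ map h τ)) (words A′ m))) ⟩
  sum (map (λ y → sum (map (λ τ → F (h y ∷ map h τ)) (words A′ m))) A′)
    ≡⟨ sum-words-suc (F ∘ map h) A′ m ⟨
  sum (map (F ∘ map h) (words A′ (suc m)))
    ∎
  where
  open ≡-Reasoning
  split : ∀ a → sum (map (λ w → if q a ∨ any q w then 0 else F (a ∷ w)) (words A m))
              ≡ (if q a then 0 else sum (map (λ w → if any q w then 0 else F (a ∷ w)) (words A m)))
  split a with q a
  ... | true  = sum-map-0 (words A m)
  ... | false = refl

punchInℕ : ℕ → ℕ → ℕ
punchInℕ zero    j       = suc j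
punchInℕ (suc i) zero    = zero
punchInℕ (suc i) (suc j) = suc (punchInℕ i j)

toℕ-punchIn : ∀ {n} (i : Fin (suc n)) (j : Fin n) → toℕ (punchIn i j) ≡ punchInℕ (toℕ i) (toℕ j)
toℕ-punchIn zero    j       = refl
toℕ-punchIn (suc i) zero    = refl
toℕ-punchIn (suc i) (suc j) = cong suc (toℕ-punchIn i j)

punchInℕ-mono-< : ∀ i {j k} → j < k → punchInℕ i j < punchInℕ i k
punchInℕ-mono-< zero    j<k               = s<s j<k
punchInℕ-mono-< (suc i) {zero}  {suc k} _ = z<s
punchInℕ-mono-< (suc i) {suc j} {suc k} (s<s j<k) = s<s (punchInℕ-mono-< i j<k)

lastNeg⇒¬lastPos : ∀ τ → lastNeg τ ≡ true → lastPos τ ≡ false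
lastNeg⇒¬lastPos (+[1+ _ ] ∷ []) ()
lastNeg⇒¬lastPos (-[1+ _ ] ∷ []) _ = refl
lastNeg⇒¬lastPos (_ ∷ y ∷ τ)     e = lastNeg⇒¬lastPos (y ∷ τ) e

-- Relabels ±[n] into ±[n+1] ∖ {±(i+1)}: signs are swapped and absolute values reversed (σ),
-- so that letters of equal sign keep their order.
module Relabel {n : ℕ} (i : Fin (suc n)) where

  σ : ℕ → ℕ
  σ u = punchInℕ (toℕ i) (n ∸ suc u)

  toℕ-punchIn-opposite : ∀ (u : Fin n) → toℕ (punchIn i (opposite u)) ≡ σ (toℕ u)
  toℕ-punchIn-opposite u = trans (toℕ-punchIn i (opposite u)) (cong (punchInℕ (toℕ i)) (opposite-prop u))

  σ-anti : ∀ {u v} → u < v → v < n → σ v < σ u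
  σ-anti u<v v<n = punchInℕ-mono-< (toℕ i) (∸-monoʳ-< (s<s u<v) v<n)

  σ-injective : ∀ {u v} → u < n → v < n → σ u ≡ σ v → u ≡ v
  σ-injective {u} {v} u<n v<n σu≡σv with <-cmp u v
  ... | tri< u<v _ _ = contradiction (sym σu≡σv) (<⇒≢ (σ-anti u<v v<n))
  ... | tri≈ _ u≡v _ = u≡v
  ... | tri> _ _ v<u = contradiction σu≡σv (<⇒≢ (σ-anti v<u u<n))

  σ-<-⇔ : ∀ {u v} → u < n → v < n → v < u ⇔ σ u < σ v
  σ-<-⇔ {u} {v} u<n v<n = mk⇔ (λ v<u → σ-anti v<u u<n) reflect
    where
    reflect : σ u < σ v → v < u
    reflect σu<σv with <-cmp u v
    ... | tri< u<v _ _ = contradiction (σ-anti u<v v<n) (<⇒≯ σu<σv)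
    ... | tri≈ _ refl _ = contradiction σu<σv (<-irrefl refl)
    ... | tri> _ _ v<u = v<u

  relabel : ℤ → ℤ
  relabel +0        = +0
  relabel +[1+ u ]  = -[1+ σ u ]
  relabel -[1+ u ]  = +[1+ σ u ]

  relabel-pos-<-⇔ : ∀ {u v} → u < n → v < n → (+[1+ v ] ℤ.< +[1+ u ]) ⇔ (-[1+ σ v ] ℤ.< -[1+ σ u ])
  relabel-pos-<-⇔ u<n v<n = mk⇔
    (ℤ.-<- ∘ Equivalence.to (σ-<-⇔ u<n v<n) ∘ s<s⁻¹ ∘ ℤ.drop‿+<+)
    (ℤ.+<+ ∘ s<s ∘ Equivalence.from (σ-<-⇔ u<n v<n) ∘ ℤ.drop‿-<-)

  relabel-neg-<-⇔ : ∀ {u v} → u < n → v < n → (-[1+ v ] ℤ.< -[1+ u ]) ⇔ (+[1+ σ v ] ℤ.< +[1+ σ u ])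
  relabel-neg-<-⇔ u<n v<n = mk⇔
    (ℤ.+<+ ∘ s<s ∘ Equivalence.to (σ-<-⇔ v<n u<n) ∘ ℤ.drop‿-<-)
    (ℤ.-<- ∘ Equivalence.from (σ-<-⇔ v<n u<n) ∘ s<s⁻¹ ∘ ℤ.drop‿+<+)

  -- comparisons of letters of equal sign are kept and those of opposite signs reversed; the sign
  -- terms telescope along a word (desB-relabel)
  relabel-descent : ∀ {y z} → Letter n y → Letter n z →
    𝟙 (y <ℤ 0ℤ) + 𝟙 (z <ℤ y) ≡ 𝟙 (relabel z <ℤ relabel y) + 𝟙 (z <ℤ 0ℤ)
  relabel-descent (pos u<n) (pos v<n) =
    trans (cong 𝟙 (isYes-⇔ (relabel-pos-<-⇔ u<n v<n) _ _)) (sym (+-identityʳ _))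
  relabel-descent (neg u<n) (neg v<n) =
    trans (cong (suc ∘ 𝟙) (isYes-⇔ (relabel-neg-<-⇔ u<n v<n) _ _)) (+-comm 1 _)
  relabel-descent (pos _)   (neg _)   = refl
  relabel-descent (neg _)   (pos _)   = refl

  desB-relabel : ∀ {y τ} → All (Letter n) (y ∷ τ) →
    desB (y ∷ τ) + 𝟙 (lastPos (y ∷ τ)) ≡ suc (descents (map relabel (y ∷ τ)))
  desB-relabel {τ = []}    (pos _ ∷ []) = refl
  desB-relabel {τ = []}    (neg _ ∷ []) = refl
  desB-relabel {y} {z ∷ τ} (ly ∷ lz ∷ lτ) = begin
    𝟙 (y <ℤ 0ℤ) + (𝟙 (z <ℤ y) + d) + l    ≡⟨ cong (_+ l) (+-assoc (𝟙 (y <ℤ 0ℤ)) _ d) ⟨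
    𝟙 (y <ℤ 0ℤ) + 𝟙 (z <ℤ y) + d + l      ≡⟨ cong (λ x → x + d + l) (relabel-descent ly lz) ⟩
    desc + 𝟙 (z <ℤ 0ℤ) + d + l            ≡⟨ cong (_+ l) (+-assoc desc _ d) ⟩
    desc + (𝟙 (z <ℤ 0ℤ) + d) + l          ≡⟨ +-assoc desc _ l ⟩
    desc + (desB (z ∷ τ) + l)             ≡⟨ cong (desc +_) (desB-relabel (lz ∷ lτ)) ⟩
    desc + suc (descents (map relabel (z ∷ τ))) ≡⟨ +-suc desc _ ⟩
    suc (descents (map relabel (y ∷ z ∷ τ)))    ∎
    where
    open ≡-Reasoning
    desc : ℕ
    desc = 𝟙 (relabel z <ℤ relabel y)
    d l : ℕ
    d = descents (z ∷ τ)
    l = 𝟙 (lastPos (z ∷ τ))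

  lastPos-relabel : ∀ τ → lastPos (map relabel τ) ≡ lastNeg τ
  lastPos-relabel []                 = refl
  lastPos-relabel (+0 ∷ [])          = refl
  lastPos-relabel (+[1+ _ ] ∷ [])    = refl
  lastPos-relabel (-[1+ _ ] ∷ [])    = refl
  lastPos-relabel (_ ∷ y ∷ τ)        = lastPos-relabel (y ∷ τ)

  lastNeg-relabel : ∀ τ → lastNeg (map relabel τ) ≡ lastPos τ
  lastNeg-relabel []                 = refl
  lastNeg-relabel (+0 ∷ [])          = refl
  lastNeg-relabel (+[1+ _ ] ∷ [])    = refl
  lastNeg-relabel (-[1+ _ ] ∷ [])    = refl
  lastNeg-relabel (_ ∷ y ∷ τ)        = lastNeg-relabel (y ∷ τ)

  relabel-lastPos-weight : ∀ (f : ℕ → ℕ) {y τ} → All (Letter n) (y ∷ τ) →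
    (if lastPos (map relabel (y ∷ τ)) then f (suc (descents (map relabel (y ∷ τ)))) else 0)
    ≡ (if lastNeg (y ∷ τ) then f (desB (y ∷ τ)) else 0)
  relabel-lastPos-weight f {y} {τ} l rewrite lastPos-relabel (y ∷ τ) with lastNeg (y ∷ τ) in eq
  ... | false = refl
  ... | true  = cong f (begin
    suc (descents (map relabel (y ∷ τ)))  ≡⟨ desB-relabel l ⟨
    desB (y ∷ τ) + 𝟙 (lastPos (y ∷ τ))
      ≡⟨ cong (λ b → desB (y ∷ τ) + 𝟙 b) (lastNeg⇒¬lastPos (y ∷ τ) eq) ⟩
    desB (y ∷ τ) + 0                      ≡⟨ +-identityʳ _ ⟩
    desB (y ∷ τ)                          ∎)
    where open ≡-Reasoning

  relabel-lastNeg-weight : ∀ (f : ℕ → ℕ) {y τ} → All (Letter n) (y ∷ τ) →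
    (if lastNeg (map relabel (y ∷ τ)) then f (suc (descents (map relabel (y ∷ τ)))) else 0)
    ≡ (if lastPos (y ∷ τ) then f (suc (desB (y ∷ τ))) else 0)
  relabel-lastNeg-weight f {y} {τ} l rewrite lastNeg-relabel (y ∷ τ) with lastPos (y ∷ τ) in eq
  ... | false = refl
  ... | true  = cong f (begin
    suc (descents (map relabel (y ∷ τ)))  ≡⟨ desB-relabel l ⟨
    desB (y ∷ τ) + 𝟙 (lastPos (y ∷ τ))    ≡⟨ cong (λ b → desB (y ∷ τ) + 𝟙 b) eq ⟩
    desB (y ∷ τ) + 1                      ≡⟨ +-comm _ 1 ⟩
    suc (desB (y ∷ τ))                    ∎)
    where open ≡-Reasoning

  suc-σ-==ℕ : ∀ {u v} → u < n → v < n → (suc (σ v) ==ℕ suc (σ u)) ≡ (suc v ==ℕ suc u)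
  suc-σ-==ℕ u<n v<n =
    isYes-⇔ (mk⇔ (cong suc ∘ σ-injective v<n u<n ∘ suc-injective) (cong (suc ∘ σ) ∘ suc-injective)) _ _

  covers-relabel : ∀ {u} → u < n → ∀ {τ} → All (Letter n) τ → covers (σ u) (map relabel τ) ≡ covers u τ
  covers-relabel u<n []             = refl
  covers-relabel u<n (pos v<n ∷ lτ) = cong₂ _∨_ (suc-σ-==ℕ u<n v<n) (covers-relabel u<n lτ)
  covers-relabel u<n (neg v<n ∷ lτ) = cong₂ _∨_ (suc-σ-==ℕ u<n v<n) (covers-relabel u<n lτ)

  suc-punchIn-≢ : ∀ u → suc (toℕ (punchIn i (opposite u))) ≢ suc (toℕ i)
  suc-punchIn-≢ u = punchInᵢ≢i i (opposite u) ∘ toℕ-injective ∘ suc-injective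

  coversAll-relabel : ∀ {τ} → All (Letter n) τ →
    coversAll (suc n) (+[1+ toℕ i ] ∷ map relabel τ) ≡ coversAll n τ
  coversAll-relabel {τ} lτ = begin
    coversAll (suc n) w
      ≡⟨ coversAll-as-⋀ (suc n) w ⟩
    ⋀ {suc n} (λ j → covers (toℕ j) w)
      ≡⟨ ∑-punchIn-opposite ∧-commutativeMonoid i (λ j → covers (toℕ j) w) ⟩
    covers (toℕ i) w ∧ ⋀ {n} (λ u → covers (toℕ (punchIn i (opposite u))) w)
      ≡⟨ cong₂ _∧_ head-covered (⋀-cong other-covered) ⟩
    true ∧ ⋀ {n} (λ u → covers (toℕ u) τ)
      ≡⟨ coversAll-as-⋀ n τ ⟨
    coversAll n τ
      ∎
    where
    open ≡-Reasoning
    w : Word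
    w = +[1+ toℕ i ] ∷ map relabel τ
    head-covered : covers (toℕ i) w ≡ true
    head-covered = cong (_∨ covers (toℕ i) (map relabel τ)) (==ℕ-refl (suc (toℕ i)))
    other-covered : ∀ u → covers (toℕ (punchIn i (opposite u))) w ≡ covers (toℕ u) τ
    other-covered u = begin
      covers (toℕ (punchIn i (opposite u))) w
        ≡⟨ cong (_∨ covers (toℕ (punchIn i (opposite u))) (map relabel τ)) (==ℕ-≢ (suc-punchIn-≢ u ∘ sym)) ⟩
      covers (toℕ (punchIn i (opposite u))) (map relabel τ)
        ≡⟨ cong (λ j → covers j (map relabel τ)) (toℕ-punchIn-opposite u) ⟩
      covers (σ (toℕ u)) (map relabel τ)
        ≡⟨ covers-relabel (toℕ<n u) lτ ⟩
      covers (toℕ u) τ ∎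

  sum-letters-relabel : ∀ (G : ℤ → ℕ) →
    sum (map (λ a → if ∣ a ∣ ==ℕ suc (toℕ i) then 0 else G a) (letters (suc n)))
    ≡ sum (map (G ∘ relabel) (letters n))
  sum-letters-relabel G = begin
    sum (map G′ (letters (suc n)))
      ≡⟨ sum-letters (suc n) G′ ⟩
    ∑[ j < suc n ] t j
      ≡⟨ ∑-punchIn-opposite +-0-commutativeMonoid i t ⟩
    t i + ∑[ u < n ] t (punchIn i (opposite u))
      ≡⟨ cong₂ _+_ t-i (∑-cong t-other) ⟩
    0 + ∑[ u < n ] (G (relabel +[1+ toℕ u ]) + G (relabel -[1+ toℕ u ]))
      ≡⟨ sum-letters n (G ∘ relabel) ⟨
    sum (map (G ∘ relabel) (letters n))
      ∎
    where
    open ≡-Reasoning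
    G′ : ℤ → ℕ
    G′ a = if ∣ a ∣ ==ℕ suc (toℕ i) then 0 else G a
    t : Fin (suc n) → ℕ
    t j = G′ +[1+ toℕ j ] + G′ -[1+ toℕ j ]
    t-i : t i ≡ 0
    t-i rewrite ==ℕ-refl (suc (toℕ i)) = refl
    t-other : ∀ u → t (punchIn i (opposite u)) ≡ G -[1+ σ (toℕ u) ] + G +[1+ σ (toℕ u) ]
    t-other u rewrite ==ℕ-≢ (suc-punchIn-≢ u) | toℕ-punchIn-opposite u = +-comm (G +[1+ σ (toℕ u) ]) _

  sum-coversAll-head : ∀ (G : Word → ℕ) →
    sum (map (λ w → if coversAll (suc n) (+[1+ toℕ i ] ∷ w) then G w else 0) (words (letters (suc n)) n))
    ≡ sum (map (λ τ → if coversAll n τ then G (map relabel τ) else 0) (words (letters n) n))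
  sum-coversAll-head G = begin
    sum (map (λ w → if coversAll (suc n) (+[1+ toℕ i ] ∷ w) then G w else 0) (words (letters (suc n)) n))
      ≡⟨ sum-map-cong (All.map (λ (len , _) → avoids-i len) (words-All (letters-Letter (suc n)) n)) ⟩
    sum (map (λ w → if covers (toℕ i) w then 0 else F w) (words (letters (suc n)) n))
      ≡⟨ sum-words-relabel (λ a → ∣ a ∣ ==ℕ suc (toℕ i)) relabel sum-letters-relabel n F ⟩
    sum (map (F ∘ map relabel) (words (letters n) n))
      ≡⟨ sum-map-cong (All.map (λ (_ , lτ) → if-cong (coversAll-relabel lτ)) (words-All (letters-Letter n) n)) ⟩
    sum (map (λ τ → if coversAll n τ then G (map relabel τ) else 0) (words (letters n) n))
      ∎
    where
    open ≡-Reasoning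
    F : Word → ℕ
    F w = if coversAll (suc n) (+[1+ toℕ i ] ∷ w) then G w else 0
    avoids-i : ∀ {w} → length w ≡ n → F w ≡ (if covers (toℕ i) w then 0 else F w)
    avoids-i {w} len with coversAll (suc n) (+[1+ toℕ i ] ∷ w) in cov
    ... | false = sym (if-eta (covers (toℕ i) w))
    ... | true  = sym (if-cong (coversAll-head⇒¬covers {n} {toℕ i} {w} len (Equivalence.from T-≡ cov)))

+<0-⇔ : ∀ x y → (x ℤ.+ y ℤ.< 0ℤ) ⇔ (y ℤ.< ℤ.- x)
+<0-⇔ x y = mk⇔ to from
  where
  to : x ℤ.+ y ℤ.< 0ℤ → y ℤ.< ℤ.- x
  to x+y<0 = subst₂ ℤ._<_ cancel (ℤ.+-identityʳ (ℤ.- x)) (ℤ.+-monoʳ-< (ℤ.- x) x+y<0)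
    where
    cancel : ℤ.- x ℤ.+ (x ℤ.+ y) ≡ y
    cancel = trans (sym (ℤ.+-assoc (ℤ.- x) x y)) (trans (cong (ℤ._+ y) (ℤ.+-inverseˡ x)) (ℤ.+-identityˡ y))
  from : y ℤ.< ℤ.- x → x ℤ.+ y ℤ.< 0ℤ
  from y<-x = subst (x ℤ.+ y ℤ.<_) (ℤ.+-inverseʳ x) (ℤ.+-monoʳ-< x y<-x)

+<ℤ0 : ∀ x y → ((x ℤ.+ y) <ℤ 0ℤ) ≡ (y <ℤ (ℤ.- x))
+<ℤ0 x y = isYes-⇔ (+<0-⇔ x y) ((x ℤ.+ y) ℤ.<? 0ℤ) (y ℤ.<? ℤ.- x)

even : ℕ → Bool
even x = (x % 2) ==ℕ 0

even-suc : ∀ x → even (suc x) ≡ not (even x)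
even-suc zero          = refl
even-suc (suc zero)    = refl
even-suc (suc (suc x)) = even-suc x

inD-negate-head : ∀ j w → inD (-[1+ j ] ∷ w) ≡ not (inD (+[1+ j ] ∷ w))
inD-negate-head j w = even-suc (negs w)

desD-negate-head : ∀ j b r → desD (-[1+ j ] ∷ b ∷ r) ≡ desD (+[1+ j ] ∷ b ∷ r)
desD-negate-head j b r = begin
  𝟙 ((-[1+ j ] ℤ.+ b) <ℤ 0ℤ) + (𝟙 (b <ℤ -[1+ j ]) + d)
    ≡⟨ cong (λ x → 𝟙 x + (𝟙 (b <ℤ -[1+ j ]) + d)) (+<ℤ0 -[1+ j ] b) ⟩
  𝟙 (b <ℤ +[1+ j ]) + (𝟙 (b <ℤ -[1+ j ]) + d)
    ≡⟨ x∙yz≈y∙xz (𝟙 (b <ℤ +[1+ j ])) _ d ⟩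
  𝟙 (b <ℤ -[1+ j ]) + (𝟙 (b <ℤ +[1+ j ]) + d)
    ≡⟨ cong (λ x → 𝟙 x + (𝟙 (b <ℤ +[1+ j ]) + d)) (+<ℤ0 +[1+ j ] b) ⟨
  𝟙 ((+[1+ j ] ℤ.+ b) <ℤ 0ℤ) + (𝟙 (b <ℤ +[1+ j ]) + d)
    ∎
  where
  open ≡-Reasoning
  d : ℕ
  d = descents (b ∷ r)

bits-swap : ∀ (f : ℕ → ℕ) p q d → (T q → T p) →
  f (𝟙 p + d) + f (suc (𝟙 q + d)) ≡ f (𝟙 q + (𝟙 p + d)) + f (suc d)
bits-swap f false false d _   = refl
bits-swap f true  false d _   = refl
bits-swap f true  true  d _   = +-comm (f (suc d)) _
bits-swap f false true  d q⇒p = contradiction (q⇒p _) (λ ())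

desB-negate-head : ∀ (f : ℕ → ℕ) j b r →
  f (desB (+[1+ j ] ∷ b ∷ r)) + f (desB (-[1+ j ] ∷ b ∷ r))
  ≡ f (desD (+[1+ j ] ∷ b ∷ r)) + f (suc (descents (b ∷ r)))
desB-negate-head f j b r = begin
  f (𝟙 (b <ℤ +[1+ j ]) + d) + f (suc (𝟙 (b <ℤ -[1+ j ]) + d))
    ≡⟨ bits-swap f (b <ℤ +[1+ j ]) (b <ℤ -[1+ j ]) d below-neg⇒below-pos ⟩
  f (𝟙 (b <ℤ -[1+ j ]) + (𝟙 (b <ℤ +[1+ j ]) + d)) + f (suc d)
    ≡⟨ cong (λ x → f (𝟙 x + (𝟙 (b <ℤ +[1+ j ]) + d)) + f (suc d)) (+<ℤ0 +[1+ j ] b) ⟨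
  f (desD (+[1+ j ] ∷ b ∷ r)) + f (suc d)
    ∎
  where
  open ≡-Reasoning
  d : ℕ
  d = descents (b ∷ r)
  below-neg⇒below-pos : T (b <ℤ -[1+ j ]) → T (b <ℤ +[1+ j ])
  below-neg⇒below-pos b<- = fromWitness (ℤ.<-trans (toWitness b<-) ℤ.-<+)

split-by : ∀ b x → (if b then x else 0) + (if not b then x else 0) ≡ x
split-by true  x = +-identityʳ x
split-by false x = refl

-- the two signs of the first letter: exactly one of them lies in 𝔇ₙ, with the same des_D
pair-weights : ∀ (f : ℕ → ℕ) (l : Bool) j b r →
  (if l then f (desB (+[1+ j ] ∷ b ∷ r)) else 0) + (if l then f (desB (-[1+ j ] ∷ b ∷ r)) else 0)
  ≡ (if inD (+[1+ j ] ∷ b ∷ r) ∧ l then f (desD (+[1+ j ] ∷ b ∷ r)) else 0)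
    + (if inD (-[1+ j ] ∷ b ∷ r) ∧ l then f (desD (-[1+ j ] ∷ b ∷ r)) else 0)
    + (if l then f (suc (descents (b ∷ r))) else 0)
pair-weights f false j b r
  rewrite ∧-zeroʳ (inD (+[1+ j ] ∷ b ∷ r)) | ∧-zeroʳ (inD (-[1+ j ] ∷ b ∷ r)) = refl
pair-weights f true  j b r
  rewrite ∧-identityʳ (inD (+[1+ j ] ∷ b ∷ r)) | ∧-identityʳ (inD (-[1+ j ] ∷ b ∷ r))
        | inD-negate-head j (b ∷ r) | desD-negate-head j b r
  = trans (desB-negate-head f j b r) (cong (_+ f (suc (descents (b ∷ r)))) (sym (split-by (inD (+[1+ j ] ∷ b ∷ r)) _)))

if-+ : ∀ b x y → (if b then x + y else 0) ≡ (if b then x else 0) + (if b then y else 0)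
if-+ true  x y = refl
if-+ false x y = refl

-- coversAll sees only |first letter|, so both signs share the covering condition
sum-signedPerms-by-head : ∀ m (g : Word → ℕ) →
  sum (map g (signedPerms (suc m)))
  ≡ ∑[ j < suc m ] sum (map (λ w → if coversAll (suc m) (+[1+ toℕ j ] ∷ w)
                                   then g (+[1+ toℕ j ] ∷ w) + g (-[1+ toℕ j ] ∷ w) else 0)
                            (words (letters (suc m)) m))
sum-signedPerms-by-head m g = begin
  sum (map g (signedPerms (suc m)))
    ≡⟨ sum-signedPerms (suc m) g ⟩
  sum (map (λ w → if coversAll (suc m) w then g w else 0) (words (letters (suc m)) (suc m)))
    ≡⟨ sum-words-suc _ (letters (suc m)) m ⟩
  sum (map (λ a → sum (map (λ w → if coversAll (suc m) (a ∷ w) then g (a ∷ w) else 0) W)) (letters (suc m)))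
    ≡⟨ sum-letters (suc m) _ ⟩
  ∑[ j < suc m ] (sum (map (λ w → if c j w then g (+[1+ toℕ j ] ∷ w) else 0) W)
                 + sum (map (λ w → if c j w then g (-[1+ toℕ j ] ∷ w) else 0) W))
    ≡⟨ ∑-cong (λ j → trans (cong sum (map-cong (λ w → if-+ (c j w) _ _) W))
                           (sum-map-+ (λ w → if c j w then g (+[1+ toℕ j ] ∷ w) else 0)
                                      (λ w → if c j w then g (-[1+ toℕ j ] ∷ w) else 0) W)) ⟨
  ∑[ j < suc m ] sum (map (λ w → if c j w then g (+[1+ toℕ j ] ∷ w) + g (-[1+ toℕ j ] ∷ w) else 0) W)
    ∎
  where
  open ≡-Reasoning
  W : List Word
  W = words (letters (suc m)) m
  c : Fin (suc m) → Word → Bool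
  c j w = coversAll (suc m) (+[1+ toℕ j ] ∷ w)

module FirstLetter (lastX : Word → Bool) (lastX-∷ : ∀ a b w → lastX (a ∷ b ∷ w) ≡ lastX (b ∷ w))
                   (f : ℕ → ℕ) (m : ℕ) where

  private
    n : ℕ
    n = suc (suc m)
    W : List Word
    W = words (letters n) (suc m)

  B-weight D-weight tail-weight : Word → ℕ
  B-weight π    = if lastX π then f (desB π) else 0
  D-weight π    = if inD π ∧ lastX π then f (desD π) else 0
  tail-weight w = if lastX w then f (suc (descents w)) else 0

  pair-step : ∀ j w → length w ≡ suc m →
    B-weight (+[1+ j ] ∷ w) + B-weight (-[1+ j ] ∷ w)
    ≡ D-weight (+[1+ j ] ∷ w) + D-weight (-[1+ j ] ∷ w) + tail-weight w
  pair-step j (b ∷ r) _ rewrite lastX-∷ +[1+ j ] b r | lastX-∷ -[1+ j ] b r = pair-weights f (lastX (b ∷ r)) j b r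

  sum-B-weight : sum (map B-weight (signedPerms n))
    ≡ sum (map D-weight (signedPerms n))
      + ∑[ j < n ] sum (map (λ w → if coversAll n (+[1+ toℕ j ] ∷ w) then tail-weight w else 0) W)
  sum-B-weight = begin
    sum (map B-weight (signedPerms n))
      ≡⟨ sum-signedPerms-by-head (suc m) B-weight ⟩
    ∑[ j < n ] sum (map (λ w → if c j w then B-weight (+[1+ toℕ j ] ∷ w) + B-weight (-[1+ toℕ j ] ∷ w) else 0) W)
      ≡⟨ ∑-cong (λ j → sum-map-cong
           (All.map (λ {w} (len , _) → if-cong-then (c j w) {y = 0} (pair-step (toℕ j) w len))
                    (words-All (letters-Letter n) (suc m)))) ⟩
    ∑[ j < n ] sum (map (λ w → if c j w then D j w + tail-weight w else 0) W)
      ≡⟨ ∑-cong (λ j → trans (cong sum (map-cong (λ w → if-+ (c j w) _ _) W))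
                             (sum-map-+ (λ w → if c j w then D j w else 0) (λ w → if c j w then tail-weight w else 0) W))
       ⟩
    ∑[ j < n ] (sum (map (λ w → if c j w then D j w else 0) W) + sum (map (λ w → if c j w then tail-weight w else 0) W))
      ≡⟨ ∑-distrib-+ (λ j → sum (map (λ w → if c j w then D j w else 0) W)) tail-sum ⟩
    ∑[ j < n ] sum (map (λ w → if c j w then D j w else 0) W) + ∑[ j < n ] tail-sum j
      ≡⟨ cong (_+ ∑[ j < n ] tail-sum j) (sum-signedPerms-by-head (suc m) D-weight) ⟨
    sum (map D-weight (signedPerms n)) + ∑[ j < n ] tail-sum j
      ∎
    where
    open ≡-Reasoning
    tail-sum : Fin n → ℕ
    tail-sum j = sum (map (λ w → if coversAll n (+[1+ toℕ j ] ∷ w) then tail-weight w else 0) W)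
    c : Fin n → Word → Bool
    c j w = coversAll n (+[1+ toℕ j ] ∷ w)
    D : Fin n → Word → ℕ
    D j w = D-weight (+[1+ toℕ j ] ∷ w) + D-weight (-[1+ toℕ j ] ∷ w)

  recurrence : (g : Word → ℕ) →
    (∀ (i : Fin n) {y τ} → All (Letter (suc m)) (y ∷ τ) →
       tail-weight (map (Relabel.relabel i) (y ∷ τ)) ≡ g (y ∷ τ)) →
    sum (map B-weight (signedPerms n)) ≡ sum (map D-weight (signedPerms n)) + n * sum (map g (signedPerms (suc m)))
  recurrence g tail-weight-relabel = begin
    sum (map B-weight (signedPerms n))
      ≡⟨ sum-B-weight ⟩
    sum (map D-weight (signedPerms n))
      + ∑[ j < n ] sum (map (λ w → if coversAll n (+[1+ toℕ j ] ∷ w) then tail-weight w else 0) W)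
      ≡⟨ cong (sum (map D-weight (signedPerms n)) +_)
              (trans (∑-cong sum-tail-weight) (∑-const n (sum (map g (signedPerms (suc m)))))) ⟩
    sum (map D-weight (signedPerms n)) + n * sum (map g (signedPerms (suc m)))
      ∎
    where
    open ≡-Reasoning
    weight-relabel : ∀ i {τ} → length τ ≡ suc m × All (Letter (suc m)) τ →
      (if coversAll (suc m) τ then tail-weight (map (Relabel.relabel i) τ) else 0)
      ≡ (if coversAll (suc m) τ then g τ else 0)
    weight-relabel i {y ∷ τ} (_ , lτ) = if-cong-then (coversAll (suc m) (y ∷ τ)) (tail-weight-relabel i lτ)
    sum-tail-weight : ∀ i → sum (map (λ w → if coversAll n (+[1+ toℕ i ] ∷ w) then tail-weight w else 0) W)
                          ≡ sum (map g (signedPerms (suc m)))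
    sum-tail-weight i = begin
      sum (map (λ w → if coversAll n (+[1+ toℕ i ] ∷ w) then tail-weight w else 0) W)
        ≡⟨ Relabel.sum-coversAll-head i tail-weight ⟩
      sum (map (λ τ → if coversAll (suc m) τ then tail-weight (map (Relabel.relabel i) τ) else 0)
               (words (letters (suc m)) (suc m)))
        ≡⟨ sum-map-cong (All.map (weight-relabel i) (words-All (letters-Letter (suc m)) (suc m))) ⟩
      sum (map (λ τ → if coversAll (suc m) τ then g τ else 0) (words (letters (suc m)) (suc m)))
        ≡⟨ sum-signedPerms (suc m) g ⟨
      sum (map g (signedPerms (suc m)))
        ∎

B⁺-recurrence : ∀ m (f : ℕ → ℕ) →
  sum (map (λ π → if lastPos π then f (desB π) else 0) (signedPerms (suc (suc m))))
  ≡ sum (map (λ π → if inD π ∧ lastPos π then f (desD π) else 0) (signedPerms (suc (suc m))))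
    + suc (suc m) * sum (map (λ τ → if lastNeg τ then f (desB τ) else 0) (signedPerms (suc m)))
B⁺-recurrence m f =
  FirstLetter.recurrence lastPos (λ _ _ _ → refl) f m _ (λ i → Relabel.relabel-lastPos-weight i f)

B⁻-recurrence : ∀ m (f : ℕ → ℕ) →
  sum (map (λ π → if lastNeg π then f (desB π) else 0) (signedPerms (suc (suc m))))
  ≡ sum (map (λ π → if inD π ∧ lastNeg π then f (desD π) else 0) (signedPerms (suc (suc m))))
    + suc (suc m) * sum (map (λ τ → if lastPos τ then f (suc (desB τ)) else 0) (signedPerms (suc m)))
B⁻-recurrence m f =
  FirstLetter.recurrence lastNeg (λ _ _ _ → refl) f m _ (λ i → Relabel.relabel-lastNeg-weight i f)

theorem1p3 : (n : ℕ) → 2 ≤ n →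
    (Bplus n ≋ (Dplus n ⊕ (n ⊙ Bminus (n ∸ 1))))
    × (Bminus n ≋ (Dminus n ⊕ (n ⊙ t· (Bplus (n ∸ 1)))))
theorem1p3 (suc (suc m)) (s≤s (s≤s z≤n)) = B⁺ , B⁻
  where
  open ≡-Reasoning
  n : ℕ
  n = suc (suc m)
  B⁺ : Bplus n ≋ (Dplus n ⊕ (n ⊙ Bminus (suc m)))
  B⁺ k = begin
    Bplus n k
      ≡⟨ genPoly-as-sum (signedPerms n) lastPos desB k ⟩
    _ ≡⟨ B⁺-recurrence m (λ d → δ d k) ⟩
    _ ≡⟨ cong₂ (λ x y → x + n * y) (genPoly-as-sum (signedPerms n) _ desD k)
                                   (genPoly-as-sum (signedPerms (suc m)) lastNeg desB k) ⟨
    Dplus n k + n * Bminus (suc m) k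
      ∎
  B⁻ : Bminus n ≋ (Dminus n ⊕ (n ⊙ t· (Bplus (suc m))))
  B⁻ k = begin
    Bminus n k
      ≡⟨ genPoly-as-sum (signedPerms n) lastNeg desB k ⟩
    _ ≡⟨ B⁻-recurrence m (λ d → δ d k) ⟩
    _ ≡⟨ cong₂ (λ x y → x + n * y) (genPoly-as-sum (signedPerms n) _ desD k)
                                   (genPoly-as-sum (signedPerms (suc m)) lastPos (suc ∘ desB) k) ⟨
    Dminus n k + n * genPoly (signedPerms (suc m)) lastPos (suc ∘ desB) k
      ≡⟨ cong (λ x → Dminus n k + n * x) (t·-genPoly (signedPerms (suc m)) lastPos desB k) ⟨
    Dminus n k + n * t· (Bplus (suc m)) k
      ∎
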